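{- The function $\max\colon\mathbb{Z}^2\to\mathbb{Z}$ does not belong to $\{\mathsf{E},\mathsf{div}_m\mid m\in\mathbb{Z}\setminus\{0\}\}^\circ$.
   Context: $\mathsf{E}(x,y)=y$ if $x=0$ and $0$ otherwise; $\mathsf{div}_m(x)=\lfloor x/m\rfloor$. For a set $F$ of functions, $F^\circ$ is the set of all functions computed by circuits whose gates compute either affine functions with integer coefficients of their inputs or functions from $F$. -}

module Defs where

open import Data.Nat as ℕ using (ℕ; zero; suc)
open import Data.Fin using (Fin; zero; suc)
open import Data.Integer using (ℤ; +_; -[1+_]; _+_; _*_; -_; _/ℕ_; 0ℤ; _⊔_)
open import Relation.Binary.PropositionalEquality using (_≡_; _≢_)
open import Relation.Nullary using (¬_)
open import Data.Product using (∃)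

E : ℤ → ℤ → ℤ
E (+ zero)    y = y
E (+ (suc _)) y = 0ℤ
E -[1+ _ ]    y = 0ℤ

-- div_m(x) = ⌊ x / m ⌋ (floor division), for m ≠ 0.
-- (_/ℕ_ is floor division by a positive natural; for negative m,
--  ⌊x/m⌋ = ⌊(-x)/|m|⌋.)  The value at m = 0 is irrelevant (never used).
div : ℤ → ℤ → ℤ
div (+ zero)    x = 0ℤ
div (+ (suc k)) x = x /ℕ suc k
div -[1+ k ]    x = (- x) /ℕ suc k

sumFin : (k : ℕ) → (Fin k → ℤ) → ℤ
sumFin zero    f = 0ℤ
sumFin (suc k) f = f zero + sumFin k (λ i → f (suc i))

-- Circuits (written as formulas / unfolded DAGs) with n inputs over the
-- basis: affine gates with integer coefficients of any arity, E, and div_m (m ≠ 0).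
data Circ (n : ℕ) : Set where
  input  : Fin n → Circ n
  affine : (k : ℕ) → (c : ℤ) → (a : Fin k → ℤ) → (Fin k → Circ n) → Circ n
  gateE  : Circ n → Circ n → Circ n
  gateDiv : (m : ℤ) → m ≢ + 0 → Circ n → Circ n

eval : {n : ℕ} → Circ n → (Fin n → ℤ) → ℤ
eval (input i)          x = x i
eval (affine k c a ch)  x = c + sumFin k (λ i → a i * eval (ch i) x)
eval (gateE g h)        x = E (eval g x) (eval h x)
eval (gateDiv m _ g)    x = div m (eval g x)

args2 : ℤ → ℤ → Fin 2 → ℤ
args2 x y zero    = x
args2 x y (suc _) = y

InClass : (ℤ → ℤ → ℤ) → Set
InClass f = ∃ λ (C : Circ 2) → ∀ x y → eval C (args2 x y) ≡ f x y

{-# OPTIONS --safe #-}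
-- On the antidiagonal t ↦ (t , -t) the maximum is |t|. Restricted to this line, every circuit
-- computes a function that agrees, on the far ends ±∞ of some sublattice Dℤ, with one affine map
-- t ↦ At + B. Affine gates preserve this after passing to a common multiple of the dilations.
-- An affine map is eventually either identically zero or never zero, so E eventually returns its
-- second argument or 0. On the sublattice (k+1)Dℤ the slope becomes a multiple of k+1, so floor
-- division by k+1 is again affine there. But D|t| has slope D at +∞ and -D at -∞.
module Submission where

open import Defs
open import Data.Integer using (_⊔_)
open import Relation.Nullary using (¬_)

open import Data.Nat as ℕ using (ℕ; zero; suc)
import Data.Nat.Properties as ℕ
open import Data.Fin using (Fin; zero; suc)
open import Data.Integer as ℤ using (ℤ; +_; -[1+_]; 0ℤ; 1ℤ; -1ℤ; -_; _/ℕ_; ∣_∣; _+_; _*_; _-_)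
open import Data.Integer.Properties
open import Data.Integer.DivMod using ([n/ℕd]*d≤n; n<s[n/ℕd]*d)
open import Data.Integer.Tactic.RingSolver using (solve-∀)
open import Algebra.Properties.AbelianGroup +-0-abelianGroup using (inverseˡ-unique)
open import Data.Product using (∃; _×_; _,_)
open import Relation.Nullary using (yes; no; contradiction)
open import Relation.Nullary.Decidable using (_×-dec_)
open import Relation.Binary.PropositionalEquality
open ≡-Reasoning

/ℕ-unique : ∀ {q n d} .{{_ : ℕ.NonZero d}} →
            q * + d ℤ.≤ n → n ℤ.< ℤ.suc q * + d → n /ℕ d ≡ q
/ℕ-unique {q} {n} {d} lower upper = ≤-antisym
  (<-suc⇒≤ (*-cancelʳ-<-nonNeg (+ d) (≤-<-trans ([n/ℕd]*d≤n n d) upper)))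
  (<-suc⇒≤ (*-cancelʳ-<-nonNeg (+ d) (≤-<-trans lower (n<s[n/ℕd]*d n d))))
  where
  <-suc⇒≤ : ∀ {i j} → i ℤ.< ℤ.suc j → i ℤ.≤ j
  <-suc⇒≤ {i} {j} i<1+j = subst (i ℤ.≤_) (pred-suc j) (i<j⇒i≤pred[j] i<1+j)

[x*d+y]/ℕd≡x+y/ℕd : ∀ x y d .{{_ : ℕ.NonZero d}} → (x * + d + y) /ℕ d ≡ x + y /ℕ d
[x*d+y]/ℕd≡x+y/ℕd x y d = /ℕ-unique
  (subst (ℤ._≤ x * + d + y) (sym (distrib x (y /ℕ d) (+ d)))      (+-monoʳ-≤ (x * + d) ([n/ℕd]*d≤n y d)))
  (subst (x * + d + y ℤ.<_) (sym (distrib-suc x (y /ℕ d) (+ d)))  (+-monoʳ-< (x * + d) (n<s[n/ℕd]*d y d)))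
  where
  distrib : ∀ x w m → (x + w) * m ≡ x * m + w * m
  distrib = solve-∀
  distrib-suc : ∀ x w m → (1ℤ + (x + w)) * m ≡ x * m + (1ℤ + w) * m
  distrib-suc = solve-∀

record Eventually (P : ℤ → Set) : Set where
  constructor beyond
  field
    threshold : ℕ
    holds     : ∀ t → threshold ℕ.≤ ∣ t ∣ → P t

eventually-map : ∀ {P Q} → (∀ {t} → P t → Q t) → Eventually P → Eventually Q
eventually-map f (beyond N p) = beyond N λ t N≤∣t∣ → f (p t N≤∣t∣)

eventually-map₂ : ∀ {P Q R} → (∀ {t} → P t → Q t → R t) → Eventually P → Eventually Q → Eventually R
eventually-map₂ f (beyond N p) (beyond M q) = beyond (N ℕ.⊔ M) λ t N⊔M≤∣t∣ →
  f (p t (ℕ.≤-trans (ℕ.m≤m⊔n N M) N⊔M≤∣t∣)) (q t (ℕ.≤-trans (ℕ.m≤n⊔m N M) N⊔M≤∣t∣))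

eventually-> : ∀ n → Eventually (λ t → n ℕ.< ∣ t ∣)
eventually-> n = beyond (suc n) λ _ n<∣t∣ → n<∣t∣

∣i∣≤∣j*i∣ : ∀ i j .{{_ : ℤ.NonZero j}} → ∣ i ∣ ℕ.≤ ∣ j * i ∣
∣i∣≤∣j*i∣ i j = subst (∣ i ∣ ℕ.≤_) (sym (abs-* j i)) (ℕ.m≤n*m ∣ i ∣ ∣ j ∣)

eventually-∘-scale : ∀ {P} k → Eventually P → Eventually (λ t → P (+ suc k * t))
eventually-∘-scale k (beyond N p) =
  beyond N λ t N≤∣t∣ → p (+ suc k * t) (ℕ.≤-trans N≤∣t∣ (∣i∣≤∣j*i∣ t (+ suc k)))

record AffineAlong (D : ℕ) (f : ℤ → ℤ) : Set where
  constructor affineAlong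
  field
    slope intercept : ℤ
    agrees          : Eventually (λ t → f (+ D * t) ≡ slope * t + intercept)

record EventuallyAffine (f : ℤ → ℤ) : Set where
  constructor eventuallyAffine
  field
    pred-dilation : ℕ
    along         : AffineAlong (suc pred-dilation) f

AffineAlong-*ʳ : ∀ {D f} k → AffineAlong D f → AffineAlong (D ℕ.* suc k) f
AffineAlong-*ʳ {D} {f} k (affineAlong A B agrees) =
  affineAlong (A * + suc k) B (eventually-map rescale (eventually-∘-scale k agrees))
  where
  rescale : ∀ {t} → f (+ D * (+ suc k * t)) ≡ A * (+ suc k * t) + B →
            f (+ (D ℕ.* suc k) * t) ≡ A * + suc k * t + B
  rescale {t} eq = begin
    f (+ (D ℕ.* suc k) * t)  ≡⟨ cong (λ c → f (c * t)) (pos-* D (suc k)) ⟩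
    f (+ D * + suc k * t)    ≡⟨ cong f (*-assoc (+ D) (+ suc k) t) ⟩
    f (+ D * (+ suc k * t))  ≡⟨ eq ⟩
    A * (+ suc k * t) + B    ≡⟨ cong (_+ B) (*-assoc A (+ suc k) t) ⟨
    A * + suc k * t + B      ∎

common-dilation : ∀ {f g} → EventuallyAffine f → EventuallyAffine g →
                  ∃ λ d → AffineAlong (suc d) f × AffineAlong (suc d) g
common-dilation {g = g} (eventuallyAffine d f-along) (eventuallyAffine e g-along) =
  _ , AffineAlong-*ʳ e f-along ,
  subst (λ D → AffineAlong D g) (ℕ.*-comm (suc e) (suc d)) (AffineAlong-*ʳ d g-along)

EventuallyAffine-lift₂ : ∀ {f g} (_∙_ : ℤ → ℤ → ℤ) →
  (∀ {D} → AffineAlong D f → AffineAlong D g → AffineAlong D (λ x → f x ∙ g x)) →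
  EventuallyAffine f → EventuallyAffine g → EventuallyAffine (λ x → f x ∙ g x)
EventuallyAffine-lift₂ _ lift f-aff g-aff with common-dilation f-aff g-aff
... | _ , f-along , g-along = eventuallyAffine _ (lift f-along g-along)

EventuallyAffine-cong : ∀ {f g} → (∀ x → f x ≡ g x) → EventuallyAffine f → EventuallyAffine g
EventuallyAffine-cong f≗g (eventuallyAffine d (affineAlong A B agrees)) =
  eventuallyAffine d (affineAlong A B (eventually-map (λ {t} → trans (sym (f≗g (+ suc d * t)))) agrees))

0*i+j≡j : ∀ i j → 0ℤ * i + j ≡ j
0*i+j≡j i j = trans (cong (_+ j) (*-zeroˡ i)) (+-identityˡ j)

const-eventuallyAffine : ∀ c → EventuallyAffine (λ _ → c)
const-eventuallyAffine c =
  eventuallyAffine 0 (affineAlong 0ℤ c (beyond 0 λ t _ → sym (0*i+j≡j t c)))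

linear-eventuallyAffine : ∀ A → EventuallyAffine (A *_)
linear-eventuallyAffine A = eventuallyAffine 0 (affineAlong A 0ℤ (beyond 0 λ t _ → begin
  A * (1ℤ * t)  ≡⟨ cong (A *_) (*-identityˡ t) ⟩
  A * t         ≡⟨ +-identityʳ (A * t) ⟨
  A * t + 0ℤ    ∎))

EventuallyAffine-*ˡ : ∀ {f} a → EventuallyAffine f → EventuallyAffine (λ x → a * f x)
EventuallyAffine-*ˡ {f} a (eventuallyAffine d (affineAlong A B agrees)) =
  eventuallyAffine d (affineAlong (a * A) (a * B) (eventually-map scale agrees))
  where
  distrib : ∀ a A t B → a * (A * t + B) ≡ a * A * t + a * B
  distrib = solve-∀
  scale : ∀ {t} → f (+ suc d * t) ≡ A * t + B → a * f (+ suc d * t) ≡ a * A * t + a * B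
  scale {t} eq = trans (cong (a *_) eq) (distrib a A t B)

AffineAlong-+ : ∀ {D f g} → AffineAlong D f → AffineAlong D g → AffineAlong D (λ x → f x + g x)
AffineAlong-+ {D} {f} {g} (affineAlong A B f-agrees) (affineAlong A′ B′ g-agrees) =
  affineAlong (A + A′) (B + B′) (eventually-map₂ add f-agrees g-agrees)
  where
  collect : ∀ A B A′ B′ t → (A * t + B) + (A′ * t + B′) ≡ (A + A′) * t + (B + B′)
  collect = solve-∀
  add : ∀ {t} → f (+ D * t) ≡ A * t + B → g (+ D * t) ≡ A′ * t + B′ →
        f (+ D * t) + g (+ D * t) ≡ (A + A′) * t + (B + B′)
  add {t} f-eq g-eq = trans (cong₂ _+_ f-eq g-eq) (collect A B A′ B′ t)

EventuallyAffine-+ : ∀ {f g} → EventuallyAffine f → EventuallyAffine g →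
                     EventuallyAffine (λ x → f x + g x)
EventuallyAffine-+ = EventuallyAffine-lift₂ _+_ AffineAlong-+

EventuallyAffine-sumFin : ∀ k (fs : Fin k → ℤ → ℤ) → (∀ i → EventuallyAffine (fs i)) →
                          EventuallyAffine (λ x → sumFin k (λ i → fs i x))
EventuallyAffine-sumFin zero    fs fs-aff = const-eventuallyAffine 0ℤ
EventuallyAffine-sumFin (suc k) fs fs-aff = EventuallyAffine-+
  (fs-aff zero) (EventuallyAffine-sumFin k (λ i → fs (suc i)) (λ i → fs-aff (suc i)))

affine-zero-beyond-intercept : ∀ {A B t} → ∣ B ∣ ℕ.< ∣ t ∣ → A * t + B ≡ 0ℤ → A ≡ 0ℤ × B ≡ 0ℤ
affine-zero-beyond-intercept {A} {B} {t} ∣B∣<∣t∣ eq with A ℤ.≟ 0ℤ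
... | yes refl = refl , trans (sym (0*i+j≡j t B)) eq
... | no A≢0   = contradiction ∣t∣≤∣B∣ (ℕ.<⇒≱ ∣B∣<∣t∣)
  where
  ∣t∣≤∣B∣ : ∣ t ∣ ℕ.≤ ∣ B ∣
  ∣t∣≤∣B∣ = ℕ.≤-trans (∣i∣≤∣j*i∣ t A {{ℤ.≢-nonZero A≢0}})
    (ℕ.≤-reflexive (trans (cong ∣_∣ (inverseˡ-unique (A * t) B eq)) (∣-i∣≡∣i∣ B)))

E-nonzero : ∀ {x} y → x ≢ 0ℤ → E x y ≡ 0ℤ
E-nonzero {+ zero}    _ x≢0 = contradiction refl x≢0
E-nonzero {+ suc _}   _ _   = refl
E-nonzero { -[1+ _ ]} _ _   = refl

AffineAlong-E : ∀ {D f g} → AffineAlong D f → AffineAlong D g →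
                AffineAlong D (λ x → E (f x) (g x))
AffineAlong-E {D} {f} {g} (affineAlong A B f-agrees) (affineAlong A′ B′ g-agrees)
  with A ℤ.≟ 0ℤ ×-dec B ℤ.≟ 0ℤ
... | yes (refl , refl) = affineAlong A′ B′ (eventually-map₂ pass f-agrees g-agrees)
  where
  pass : ∀ {t} → f (+ D * t) ≡ 0ℤ * t + 0ℤ → g (+ D * t) ≡ A′ * t + B′ →
         E (f (+ D * t)) (g (+ D * t)) ≡ A′ * t + B′
  pass {t} f-eq g-eq rewrite f-eq | 0*i+j≡j t 0ℤ = g-eq
... | no ¬A≡0×B≡0 = affineAlong 0ℤ 0ℤ (eventually-map₂ vanish f-agrees (eventually-> ∣ B ∣))
  where
  vanish : ∀ {t} → f (+ D * t) ≡ A * t + B → ∣ B ∣ ℕ.< ∣ t ∣ →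
           E (f (+ D * t)) (g (+ D * t)) ≡ 0ℤ * t + 0ℤ
  vanish {t} f-eq ∣B∣<∣t∣ = trans
    (E-nonzero _ λ f≡0 → ¬A≡0×B≡0 (affine-zero-beyond-intercept ∣B∣<∣t∣ (trans (sym f-eq) f≡0)))
    (sym (0*i+j≡j t 0ℤ))

AffineAlong-/ℕ : ∀ {D f} k → AffineAlong D f → AffineAlong (D ℕ.* suc k) (λ x → f x /ℕ suc k)
AffineAlong-/ℕ {D} {f} k along@(affineAlong A B _) =
  affineAlong A (B /ℕ suc k) (eventually-map divide (AffineAlong.agrees (AffineAlong-*ʳ k along)))
  where
  *-rotate : ∀ a b c → a * b * c ≡ a * c * b
  *-rotate = solve-∀
  divide : ∀ {t} → f (+ (D ℕ.* suc k) * t) ≡ A * + suc k * t + B →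
           f (+ (D ℕ.* suc k) * t) /ℕ suc k ≡ A * t + B /ℕ suc k
  divide {t} eq = begin
    f (+ (D ℕ.* suc k) * t) /ℕ suc k  ≡⟨ cong (_/ℕ suc k) eq ⟩
    (A * + suc k * t + B) /ℕ suc k    ≡⟨ cong (λ x → (x + B) /ℕ suc k) (*-rotate A (+ suc k) t) ⟩
    (A * t * + suc k + B) /ℕ suc k    ≡⟨ [x*d+y]/ℕd≡x+y/ℕd (A * t) B (suc k) ⟩
    A * t + B /ℕ suc k                ∎

EventuallyAffine-/ℕ : ∀ {f} k → EventuallyAffine f → EventuallyAffine (λ x → f x /ℕ suc k)
EventuallyAffine-/ℕ k (eventuallyAffine _ along) = eventuallyAffine _ (AffineAlong-/ℕ k along)

EventuallyAffine-div : ∀ {f} m → m ≢ 0ℤ → EventuallyAffine f → EventuallyAffine (λ x → div m (f x))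
EventuallyAffine-div (+ zero)  m≢0 _     = contradiction refl m≢0
EventuallyAffine-div (+ suc k) _   f-aff = EventuallyAffine-/ℕ k f-aff
EventuallyAffine-div -[1+ k ]  _   f-aff = EventuallyAffine-/ℕ k
  (EventuallyAffine-cong (λ x → -1*i≡-i _) (EventuallyAffine-*ˡ -1ℤ f-aff))

eval-eventuallyAffine : ∀ {n} (x : ℤ → Fin n → ℤ) → (∀ i → EventuallyAffine (λ t → x t i)) →
                        ∀ C → EventuallyAffine (λ t → eval C (x t))
eval-eventuallyAffine x x-aff (input i)         = x-aff i
eval-eventuallyAffine x x-aff (affine k c a ch) = EventuallyAffine-+ (const-eventuallyAffine c)
  (EventuallyAffine-sumFin k _ λ i → EventuallyAffine-*ˡ (a i) (eval-eventuallyAffine x x-aff (ch i)))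
eval-eventuallyAffine x x-aff (gateE g h)       = EventuallyAffine-lift₂ E AffineAlong-E
  (eval-eventuallyAffine x x-aff g) (eval-eventuallyAffine x x-aff h)
eval-eventuallyAffine x x-aff (gateDiv m m≢0 g) =
  EventuallyAffine-div m m≢0 (eval-eventuallyAffine x x-aff g)

scaled-abs-fit⇒D+D≡0 : ∀ D A B u →
  D * u ≡ A * u + B → D * (1ℤ + u) ≡ A * (1ℤ + u) + B →
  D * u ≡ A * (- u) + B → D * (1ℤ + u) ≡ A * (- (1ℤ + u)) + B → D + D ≡ 0ℤ
scaled-abs-fit⇒D+D≡0 D A B u fit₁ fit₂ fit₃ fit₄ = begin
  D + D                                              ≡⟨ differences D u ⟩
  (D * (1ℤ + u) - D * u) + (D * (1ℤ + u) - D * u)    ≡⟨ cong₂ _+_ (cong₂ _-_ fit₂ fit₁) (cong₂ _-_ fit₄ fit₃) ⟩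
  ((A * (1ℤ + u) + B) - (A * u + B)) + ((A * (- (1ℤ + u)) + B) - (A * (- u) + B)) ≡⟨ cancel A B u ⟩
  0ℤ                                                 ∎
  where
  differences : ∀ D u → D + D ≡ (D * (1ℤ + u) - D * u) + (D * (1ℤ + u) - D * u)
  differences = solve-∀
  cancel : ∀ A B u → ((A * (1ℤ + u) + B) - (A * u + B)) + ((A * (- (1ℤ + u)) + B) - (A * (- u) + B)) ≡ 0ℤ
  cancel = solve-∀

∣∣-not-eventuallyAffine : ¬ EventuallyAffine (λ t → + ∣ t ∣)
∣∣-not-eventuallyAffine (eventuallyAffine d (affineAlong A B (beyond N agrees))) =
  contradiction (scaled-abs-fit⇒D+D≡0 (+ suc d) A B (+ suc N)
    (fit (+ suc N) (ℕ.n≤1+n N))   (fit (+ suc (suc N)) (ℕ.m≤n+m N 2))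
    (fit -[1+ N ] (ℕ.n≤1+n N))    (fit -[1+ suc N ] (ℕ.m≤n+m N 2)))
  λ ()
  where
  fit : ∀ t → N ℕ.≤ ∣ t ∣ → + suc d * + ∣ t ∣ ≡ A * t + B
  fit t N≤∣t∣ = begin
    + suc d * + ∣ t ∣       ≡⟨ pos-* (suc d) ∣ t ∣ ⟨
    + (suc d ℕ.* ∣ t ∣)     ≡⟨ cong +_ (abs-* (+ suc d) t) ⟨
    + ∣ + suc d * t ∣       ≡⟨ agrees t N≤∣t∣ ⟩
    A * t + B               ∎

+∣i∣≡i⊔-i : ∀ i → + ∣ i ∣ ≡ i ⊔ - i
+∣i∣≡i⊔-i (+ zero)  = refl
+∣i∣≡i⊔-i (+ suc _) = refl
+∣i∣≡i⊔-i -[1+ _ ]  = refl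

mainTheorem8 : ¬ InClass _⊔_
mainTheorem8 (C , C-computes-max) = ∣∣-not-eventuallyAffine
  (EventuallyAffine-cong (λ t → trans (C-computes-max t (- t)) (sym (+∣i∣≡i⊔-i t)))
    (eval-eventuallyAffine (λ t → args2 t (- t)) antidiagonal-affine C))
  where
  antidiagonal-affine : ∀ i → EventuallyAffine (λ t → args2 t (- t) i)
  antidiagonal-affine zero    = EventuallyAffine-cong *-identityˡ (linear-eventuallyAffine 1ℤ)
  antidiagonal-affine (suc _) = EventuallyAffine-cong -1*i≡-i (linear-eventuallyAffine -1ℤ)
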